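{- Let $G$ be the cyclic group of order $n$, let $H$ be the set of non-generators of $G$, and let $\mathfrak{H}$ be the subgraph of the power graph $\mathfrak{g}(G)$ induced on $H$. Then $\chi(\mathfrak{g}(G))=\varphi(n)+\chi(\mathfrak{H})$.
   Context: The power graph $\mathfrak{g}(G)$ of a group $G$ has vertex set $G$, distinct $x,y$ adjacent iff $\langle x\rangle\le\langle y\rangle$ or $\langle y\rangle\le\langle x\rangle$. $\chi$ denotes chromatic number and $\varphi$ Euler's totient function. -}

module Defs where

open import Data.Nat using (ℕ; suc; _*_; _<_; NonZero)
open import Data.Nat.DivMod using (_%_)
open import Data.Nat.GCD using (gcd)
open import Data.Nat.Properties using (_≟_)
open import Data.Fin using (Fin; toℕ)
open import Data.List using (List; length; filter; map; upTo)
open import Data.Product using (Σ; ∃; _×_; proj₁)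
open import Data.Sum using (_⊎_)
open import Relation.Nullary using (¬_)
open import Relation.Binary.PropositionalEquality using (_≡_; _≢_)

φ : ℕ → ℕ
φ n = length (filter (λ k → gcd k n ≟ 1) (map suc (upTo n)))

-- The cyclic group of order n, realised as ℤ/nℤ with carrier Fin n
-- (addition mod n).  x ∈⟨ y ⟩ : x lies in the cyclic subgroup generated
-- by y, i.e. x = k·y in ℤ/nℤ for some k ∈ ℕ.
_∈⟨_⟩ : {n : ℕ} .{{_ : NonZero n}} → Fin n → Fin n → Set
_∈⟨_⟩ {n} x y = ∃ λ (k : ℕ) → toℕ x ≡ (k * toℕ y) % n

PowerAdj : (n : ℕ) .{{_ : NonZero n}} → Fin n → Fin n → Set
PowerAdj n x y = x ≢ y × (x ∈⟨ y ⟩ ⊎ y ∈⟨ x ⟩)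

IsGenerator : (n : ℕ) .{{_ : NonZero n}} → Fin n → Set
IsGenerator n x = ∀ (y : Fin n) → y ∈⟨ x ⟩

NonGen : (n : ℕ) .{{_ : NonZero n}} → Set
NonGen n = Σ (Fin n) (λ x → ¬ IsGenerator n x)

NonGenAdj : (n : ℕ) .{{_ : NonZero n}} → NonGen n → NonGen n → Set
NonGenAdj n u v = PowerAdj n (proj₁ u) (proj₁ v)

Colourable : (V : Set) → (V → V → Set) → ℕ → Set
Colourable V Adj k = Σ (V → Fin k) λ c → ∀ u v → Adj u v → c u ≢ c v

IsChromaticNumber : (V : Set) → (V → V → Set) → ℕ → Set
IsChromaticNumber V Adj k = Colourable V Adj k × (∀ m → m < k → ¬ Colourable V Adj m)

-- A generator g of ℤ/nℤ satisfies ⟨x⟩ ≤ ⟨g⟩ = G for every x, so it is adjacent to every other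
-- vertex of the power graph: the generators are universal vertices, and they are exactly the
-- residues coprime to n, so there are φ(n) of them.  In any proper colouring, universal vertices receive pairwise distinct colours that no
-- other vertex uses, so deleting them saves exactly their number of colours; conversely, a colouring
-- of the rest extends by giving each universal vertex a fresh colour of its own.
module Submission where

open import Level using (Level)
open import Data.Nat using (ℕ; zero; suc; _+_; _*_; _≤_; NonZero)
open import Data.Nat.Properties using (_≟_; ≤-antisym; ≤-trans; ≮⇒≥; +-monoʳ-≤; +-comm; *-assoc; *-identityʳ)
open import Data.Nat.DivMod using (_%_; _/_; [m+kn]%n≡m%n; %-distribˡ-*; m<n⇒m%n≡m; m%n<n; m≡m%n+[m/n]*n)
open import Data.Nat.Divisibility using (_∣_; ∣-refl; ∣-antisym; ∣n⇒∣m*n; ∣m∣n⇒∣m+n; ∣1⇒≡1; %-presˡ-∣)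
open import Data.Nat.GCD using (gcd; gcd[m,n]∣m; gcd[m,n]∣n; gcd-greatest; gcd-identityˡ; module Bézout)
open import Data.Nat.Coprimality using (coprime-Bézout; gcd≡1⇒coprime)
open import Data.Nat.Solver using (module +-*-Solver)
open import Data.Fin as Fin using (Fin; toℕ; fromℕ<; join; splitAt)
open import Data.Fin.Properties as Fin using (toℕ<n; toℕ-fromℕ<; any?; injective⇒≤; join-splitAt; splitAt-join)
open import Data.List using (List; []; _∷_; [_]; _++_; _∷ʳ_; length; filter; lookup; map; upTo; applyUpTo; allFin; tabulate)
open import Data.List.Properties using (filter-++; length-++; applyUpTo-∷ʳ; map-upTo; map-tabulate; filter-≐)
open import Data.List.Relation.Unary.All as All using ()
open import Data.List.Relation.Unary.All.Properties using (all-filter)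
open import Data.List.Relation.Unary.Any using (index)
open import Data.List.Relation.Unary.Unique.Propositional using (Unique; _∷_)
open import Data.List.Relation.Unary.Unique.Propositional.Properties using (allFin⁺; filter⁺)
open import Data.List.Membership.Propositional.Properties using (∈-lookup; ∈-filter⁺; ∈-allFin)
open import Data.List.Membership.Setoid.Properties using (index-injective)
open import Data.Product using (Σ; ∃; ∃-syntax; _×_; _,_; proj₁; proj₂)
open import Data.Sum using (_⊎_; inj₁; inj₂)
open import Data.Sum.Properties using (inj₁-injective; inj₂-injective)
open import Function using (_∘_)
open import Function.Definitions using (Injective)
open import Relation.Nullary using (¬_; Dec; yes; no; contradiction)
open import Relation.Nullary.Decidable using (map′; _×-dec_; ¬?)
open import Relation.Unary using (Pred; Decidable)
open import Relation.Binary.Definitions using (Irreflexive)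
open import Relation.Binary.PropositionalEquality using (_≡_; _≢_; refl; sym; trans; cong; subst; setoid; module ≡-Reasoning)

open import Defs

lookup-injective : ∀ {a} {A : Set a} {xs : List A} → Unique xs →
                   ∀ {i j} → lookup xs i ≡ lookup xs j → i ≡ j
lookup-injective (_    ∷ _)   {Fin.zero}  {Fin.zero}  _  = refl
lookup-injective (x∉xs ∷ _)   {Fin.zero}  {Fin.suc j} eq = contradiction eq (All.lookup x∉xs (∈-lookup j))
lookup-injective (x∉xs ∷ _)   {Fin.suc i} {Fin.zero}  eq = contradiction (sym eq) (All.lookup x∉xs (∈-lookup i))
lookup-injective (_    ∷ xs!) {Fin.suc i} {Fin.suc j} eq = cong Fin.suc (lookup-injective xs! eq)

map-toℕ-allFin : ∀ n → map toℕ (allFin n) ≡ upTo n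
map-toℕ-allFin zero = refl
map-toℕ-allFin (suc n) = cong (0 ∷_) (begin
    map toℕ (tabulate Fin.suc)      ≡⟨ map-tabulate Fin.suc toℕ ⟩
    tabulate (suc ∘ toℕ)            ≡⟨ map-tabulate toℕ suc ⟨
    map suc (tabulate toℕ)          ≡⟨ cong (map suc) (map-tabulate (λ i → i) toℕ) ⟨
    map suc (map toℕ (allFin n))    ≡⟨ cong (map suc) (map-toℕ-allFin n) ⟩
    map suc (upTo n)                ≡⟨ map-upTo suc n ⟩
    applyUpTo suc n                 ∎)
  where open ≡-Reasoning

module Enumeration {p : Level} {n : ℕ} {P : Pred (Fin n) p} (P? : Decidable P) where

  members : List (Fin n)
  members = filter P? (allFin n)

  count : ℕ
  count = length members

  rank : Σ (Fin n) P → Fin count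
  rank (x , px) = index (∈-filter⁺ P? (∈-allFin x) px)

  rank-injective : ∀ {x y} {px : P x} {py : P y} → rank (x , px) ≡ rank (y , py) → x ≡ y
  rank-injective = index-injective (setoid (Fin n)) _ _

  unrank : Fin count → Σ (Fin n) P
  unrank k = lookup members k , All.lookup (all-filter P? (allFin n)) (∈-lookup k)

  unrank-injective : ∀ {k l} → proj₁ (unrank k) ≡ proj₁ (unrank l) → k ≡ l
  unrank-injective = lookup-injective (filter⁺ P? (allFin⁺ n))

module _ {a p} {A : Set a} {P : Pred A p} (P? : Decidable P) where

  length-filter-∷ʳ : ∀ xs x → length (filter P? (xs ∷ʳ x)) ≡ length (filter P? (x ∷ xs))
  length-filter-∷ʳ xs x = begin
      length (filter P? (xs ++ [ x ]))                    ≡⟨ cong length (filter-++ P? xs [ x ]) ⟩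
      length (filter P? xs ++ filter P? [ x ])            ≡⟨ length-++ (filter P? xs) ⟩
      length (filter P? xs) + length (filter P? [ x ])    ≡⟨ +-comm (length (filter P? xs)) _ ⟩
      length (filter P? [ x ]) + length (filter P? xs)    ≡⟨ length-++ (filter P? [ x ]) ⟨
      length (filter P? [ x ] ++ filter P? xs)            ≡⟨ cong length (filter-++ P? [ x ] xs) ⟨
      length (filter P? (x ∷ xs))                         ∎
    where open ≡-Reasoning

  length-filter-∷-resp : ∀ {x y} → (P x → P y) → (P y → P x) → ∀ xs →
                         length (filter P? (x ∷ xs)) ≡ length (filter P? (y ∷ xs))
  length-filter-∷-resp {x} {y} to from xs with P? x | P? y
  ... | yes _  | yes _  = refl
  ... | no _   | no _   = refl
  ... | yes px | no ¬py = contradiction (to px) ¬py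
  ... | no ¬px | yes py = contradiction (from py) ¬px

module _ {b p} {B : Set b} {P : Pred B p} (P? : Decidable P) where

  length-filter-map : ∀ {a} {A : Set a} (f : A → B) xs → length (filter P? (map f xs)) ≡ length (filter (P? ∘ f) xs)
  length-filter-map f [] = refl
  length-filter-map f (x ∷ xs) with P? (f x)
  ... | yes _ = cong suc (length-filter-map f xs)
  ... | no _  = length-filter-map f xs

module _ {p} {P : Pred ℕ p} (P? : Decidable P) where

  length-filter-shift : ∀ m → (P m → P 0) → (P 0 → P m) →
                        length (filter P? (map suc (upTo m))) ≡ length (filter P? (upTo m))
  length-filter-shift zero _ _ = refl
  length-filter-shift (suc m) to from = begin
      length (filter P? (map suc (upTo (suc m))))       ≡⟨ cong (length ∘ filter P?) (map-upTo suc (suc m)) ⟩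
      length (filter P? (applyUpTo suc (suc m)))        ≡⟨ cong (length ∘ filter P?) (applyUpTo-∷ʳ suc m) ⟨
      length (filter P? (applyUpTo suc m ∷ʳ suc m))     ≡⟨ length-filter-∷ʳ P? (applyUpTo suc m) (suc m) ⟩
      length (filter P? (suc m ∷ applyUpTo suc m))      ≡⟨ length-filter-∷-resp P? to from (applyUpTo suc m) ⟩
      length (filter P? (upTo (suc m)))                 ∎
    where open ≡-Reasoning

⊎-injective⇒≤ : ∀ {k m a} {f : Fin k ⊎ Fin m → Fin a} → Injective _≡_ _≡_ f → k + m ≤ a
⊎-injective⇒≤ {k} {m} f-inj = injective⇒≤ λ {i} {j} eq → begin
    i                        ≡⟨ join-splitAt k m i ⟨
    join k m (splitAt k i)   ≡⟨ cong (join k m) (f-inj {splitAt k i} {splitAt k j} eq) ⟩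
    join k m (splitAt k j)   ≡⟨ join-splitAt k m j ⟩
    j                        ∎
  where open ≡-Reasoning

colourable-⊎ : ∀ {V : Set} {Adj : V → V → Set} {k m} (c : V → Fin k ⊎ Fin m) →
               (∀ u v → Adj u v → c u ≢ c v) → Colourable V Adj (k + m)
colourable-⊎ {k = k} {m} c proper = join k m ∘ c , λ u v adj eq → proper u v adj (begin
    c u                        ≡⟨ splitAt-join k m (c u) ⟨
    splitAt k (join k m (c u)) ≡⟨ cong (splitAt k) eq ⟩
    splitAt k (join k m (c v)) ≡⟨ splitAt-join k m (c v) ⟩
    c v                        ∎)
  where open ≡-Reasoning

chromatic≤colourable : ∀ {V : Set} {Adj : V → V → Set} {k m} →
                       IsChromaticNumber V Adj k → Colourable V Adj m → k ≤ m
chromatic≤colourable (_ , minimal) col = ≮⇒≥ λ m<k → minimal _ m<k col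

Universal : ∀ {V : Set} → (V → V → Set) → V → Set
Universal Adj u = ∀ v → u ≢ v → Adj u v

module UniversalVertices {N : ℕ} (Adj : Fin N → Fin N → Set) (irreflexive : Irreflexive _≡_ Adj)
                         {U : Fin N → Set} (U? : Decidable U) (universal : ∀ {u} → U u → Universal Adj u) where

  Rest : Set
  Rest = Σ (Fin N) (λ x → ¬ U x)

  RestAdj : Rest → Rest → Set
  RestAdj x y = Adj (proj₁ x) (proj₁ y)

  open Enumeration U? using (count; rank; rank-injective; unrank)

  module _ {m} (c : Rest → Fin m) (proper : ∀ x y → RestAdj x y → c x ≢ c y) where

    extension : (x : Fin N) → Dec (U x) → Fin count ⊎ Fin m
    extension x (yes ux) = inj₁ (rank (x , ux))
    extension x (no ¬ux) = inj₂ (c (x , ¬ux))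

    extension-proper : ∀ {x y} → Adj x y → (ux? : Dec (U x)) (uy? : Dec (U y)) → extension x ux? ≢ extension y uy?
    extension-proper adj (yes _)   (yes _)   eq = irreflexive (rank-injective (inj₁-injective eq)) adj
    extension-proper adj (no ¬ux)  (no ¬uy)  eq = proper _ _ adj (inj₂-injective eq)
    extension-proper adj (yes _)   (no _)    ()
    extension-proper adj (no _)    (yes _)   ()

  colourable-extend : ∀ {m} → Colourable Rest RestAdj m → Colourable (Fin N) Adj (count + m)
  colourable-extend (c , proper) =
    colourable-⊎ (λ x → extension c proper x (U? x)) λ x y adj → extension-proper c proper adj (U? x) (U? y)

  module _ {a} (c : Fin N → Fin a) (proper : ∀ x y → Adj x y → c x ≢ c y) where

    UnusedOnU : Fin a → Set
    UnusedOnU j = ¬ (∃[ u ] U u × c u ≡ j)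

    unused? : Decidable UnusedOnU
    unused? j = ¬? (any? λ u → U? u ×-dec (c u Fin.≟ j))

    module Unused = Enumeration unused?

    rest-colour-unused : (x : Rest) → UnusedOnU (c (proj₁ x))
    rest-colour-unused (x , ¬ux) (u , uu , cu≡cx) = proper u x (universal uu x λ { refl → ¬ux uu }) cu≡cx

    restColouring : Colourable Rest RestAdj Unused.count
    restColouring = (λ x → Unused.rank (c (proj₁ x) , rest-colour-unused x))
                  , λ x y adj eq → proper _ _ adj (Unused.rank-injective eq)

    c-injective-on-U : ∀ {u v} → U u → U v → c u ≡ c v → u ≡ v
    c-injective-on-U {u} {v} uu _ cu≡cv with u Fin.≟ v
    ... | yes u≡v = u≡v
    ... | no  u≢v = contradiction cu≡cv (proper u v (universal uu v u≢v))

    colours : Fin count ⊎ Fin Unused.count → Fin a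
    colours (inj₁ i) = c (proj₁ (unrank i))
    colours (inj₂ j) = proj₁ (Unused.unrank j)

    colours-injective : Injective _≡_ _≡_ colours
    colours-injective {inj₁ i} {inj₁ i′} eq =
      cong inj₁ (Enumeration.unrank-injective U? (c-injective-on-U (proj₂ (unrank i)) (proj₂ (unrank i′)) eq))
    colours-injective {inj₁ i} {inj₂ j} eq = contradiction (_ , proj₂ (unrank i) , eq) (proj₂ (Unused.unrank j))
    colours-injective {inj₂ j} {inj₁ i} eq = contradiction (_ , proj₂ (unrank i) , sym eq) (proj₂ (Unused.unrank j))
    colours-injective {inj₂ j} {inj₂ j′} eq = cong inj₂ (Unused.unrank-injective eq)

  colourable-restrict : ∀ {a} → Colourable (Fin N) Adj a → ∃[ m ] count + m ≤ a × Colourable Rest RestAdj m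
  colourable-restrict (c , proper) = Unused.count c proper , ⊎-injective⇒≤ (colours-injective c proper) , restColouring c proper

  chromatic-remove-universal : ∀ {a b} → IsChromaticNumber (Fin N) Adj a → IsChromaticNumber Rest RestAdj b → a ≡ count + b
  chromatic-remove-universal χa@(colA , _) χb@(colB , _) with colourable-restrict colA
  ... | m , count+m≤a , colM = ≤-antisym (chromatic≤colourable χa (colourable-extend colB))
                                         (≤-trans (+-monoʳ-≤ count (chromatic≤colourable χb colM)) count+m≤a)

gcd[n,n]≡gcd[0,n] : ∀ n → gcd n n ≡ gcd 0 n
gcd[n,n]≡gcd[0,n] n = trans (∣-antisym (gcd[m,n]∣m n n) (gcd-greatest ∣-refl ∣-refl)) (sym (gcd-identityˡ n))

module _ (n : ℕ) .{{_ : NonZero n}} where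

  open ≡-Reasoning

  square-of-minus-one : ∀ w v → 1 + w ≡ v * n → (w * w) % n ≡ 1 % n
  square-of-minus-one w v 1+w≡vn = begin
      (w * w) % n                  ≡⟨ [m+kn]%n≡m%n (w * w) (2 * v) n ⟨
      (w * w + 2 * v * n) % n      ≡⟨ cong (_% n) expand ⟩
      (1 + v * v * n * n) % n      ≡⟨ [m+kn]%n≡m%n 1 (v * v * n) n ⟩
      1 % n                        ∎
    where
      open +-*-Solver
      expand : w * w + 2 * v * n ≡ 1 + v * v * n * n
      expand = begin
          w * w + 2 * v * n          ≡⟨ cong (w * w +_) (trans (*-assoc 2 v n) (cong (2 *_) (sym 1+w≡vn))) ⟩
          w * w + 2 * (1 + w)        ≡⟨ solve 1 (λ w → w :* w :+ con 2 :* (con 1 :+ w) := con 1 :+ (con 1 :+ w) :* (con 1 :+ w)) refl w ⟩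
          1 + (1 + w) * (1 + w)      ≡⟨ cong (λ t → 1 + t * t) 1+w≡vn ⟩
          1 + (v * n) * (v * n)      ≡⟨ cong (1 +_) (solve 2 (λ v n → (v :* n) :* (v :* n) := v :* v :* n :* n) refl v n) ⟩
          1 + v * v * n * n          ∎

  coprime? : Decidable (λ k → gcd k n ≡ 1)
  coprime? k = gcd k n ≟ 1

  -- Bézout in ℕ only gives x t ≡ ±1 (mod n); in the −1 case the inverse is x t x, as (x t)² ≡ 1.
  coprime⇒invertible : ∀ t → gcd t n ≡ 1 → ∃ λ c → (c * t) % n ≡ 1 % n
  coprime⇒invertible t gcd≡1 with coprime-Bézout (gcd≡1⇒coprime gcd≡1)
  ... | Bézout.+- x y 1+yn≡xt = x , trans (cong (_% n) (sym 1+yn≡xt)) ([m+kn]%n≡m%n 1 y n)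
  ... | Bézout.-+ x y 1+xt≡yn = x * t * x , trans (cong (_% n) (*-assoc (x * t) x t)) (square-of-minus-one (x * t) y 1+xt≡yn)

  coprime⇒generator : ∀ x → gcd (toℕ x) n ≡ 1 → IsGenerator n x
  coprime⇒generator x gcd≡1 y with coprime⇒invertible (toℕ x) gcd≡1
  ... | c , ct≡1 = toℕ y * c , sym (begin
      (toℕ y * c * toℕ x) % n                  ≡⟨ cong (_% n) (*-assoc (toℕ y) c (toℕ x)) ⟩
      (toℕ y * (c * toℕ x)) % n                ≡⟨ %-distribˡ-* (toℕ y) (c * toℕ x) n ⟩
      ((toℕ y % n) * ((c * toℕ x) % n)) % n    ≡⟨ cong (λ z → ((toℕ y % n) * z) % n) ct≡1 ⟩
      ((toℕ y % n) * (1 % n)) % n              ≡⟨ %-distribˡ-* (toℕ y) 1 n ⟨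
      (toℕ y * 1) % n                          ≡⟨ cong (_% n) (*-identityʳ (toℕ y)) ⟩
      toℕ y % n                                ≡⟨ m<n⇒m%n≡m (toℕ<n y) ⟩
      toℕ y                                    ∎)

  generator⇒coprime : ∀ x → IsGenerator n x → gcd (toℕ x) n ≡ 1
  generator⇒coprime x generates with generates (fromℕ< (m%n<n 1 n))
  ... | k , 1%n≡kx%n = ∣1⇒≡1 d∣1
    where
      d = gcd (toℕ x) n
      d∣n : d ∣ n
      d∣n = gcd[m,n]∣n (toℕ x) n
      d∣1%n : d ∣ 1 % n
      d∣1%n = subst (d ∣_) (trans (sym 1%n≡kx%n) (toℕ-fromℕ< (m%n<n 1 n)))
                    (%-presˡ-∣ (∣n⇒∣m*n k (gcd[m,n]∣m (toℕ x) n)) d∣n)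
      d∣1 : d ∣ 1
      d∣1 = subst (d ∣_) (sym (m≡m%n+[m/n]*n 1 n)) (∣m∣n⇒∣m+n d∣1%n (∣n⇒∣m*n (1 / n) d∣n))

  generator? : Decidable (IsGenerator n)
  generator? x = map′ (coprime⇒generator x) (generator⇒coprime x) (coprime? (toℕ x))

  generator-universal : ∀ {g} → IsGenerator n g → Universal (PowerAdj n) g
  generator-universal generates x g≢x = g≢x , inj₂ (generates x)

  powerAdj-irreflexive : Irreflexive _≡_ (PowerAdj n)
  powerAdj-irreflexive x≡y (x≢y , _) = x≢y x≡y

  -- φ counts over 1, …, n and the vertices are 0, …, n − 1; the two ends agree as gcd n n = gcd 0 n.
  φ≡count-generators : φ n ≡ Enumeration.count generator?
  φ≡count-generators = begin
      φ n                                                  ≡⟨ length-filter-shift coprime? n (trans (sym ends)) (trans ends) ⟩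
      length (filter coprime? (upTo n))                    ≡⟨ cong (length ∘ filter coprime?) (map-toℕ-allFin n) ⟨
      length (filter coprime? (map toℕ (allFin n)))        ≡⟨ length-filter-map coprime? toℕ (allFin n) ⟩
      length (filter (coprime? ∘ toℕ) (allFin n))          ≡⟨ cong length (filter-≐ (coprime? ∘ toℕ) generator?
                                                                (coprime⇒generator _ , generator⇒coprime _) (allFin n)) ⟩
      length (filter generator? (allFin n))                ∎
    where ends = gcd[n,n]≡gcd[0,n] n

proposition24 : (n : ℕ) .{{_ : NonZero n}} → (a b : ℕ)
    → IsChromaticNumber (Fin n) (PowerAdj n) a
    → IsChromaticNumber (NonGen n) (NonGenAdj n) b
    → a ≡ φ n + b
proposition24 n a b χa χb = begin
    a                   ≡⟨ chromatic-remove-universal χa χb ⟩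
    count + b           ≡⟨ cong (_+ b) (φ≡count-generators n) ⟨
    φ n + b             ∎
  where
    open ≡-Reasoning
    open UniversalVertices (PowerAdj n) (powerAdj-irreflexive n) (generator? n) (generator-universal n)
    open Enumeration (generator? n) using (count)
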